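{- Let $m\ge1$ and $\alpha\in\mathbb N\cup\{\omega\}$ with $1<2m<\alpha\le\omega$. Then $G_{O^\alpha_m}\le G_{O^\alpha_{m+1}}$ and $G_{O^\alpha_{m+1}}\not\le G_{O^\alpha_m}$ (i.e. $O^\alpha_m<O^\alpha_{m+1}$ in $M^*$).
   Context: Notation: $ex$ is the (possibly undefined) result of applying the $e$-th partial recursive function to $x$. For $A,C\subseteq\mathbb N$, $A\to C=\{e\mid\forall a\in A\ (ea\text{ defined and in }C)\}$. For a nonempty family ${\cal A}$ of subsets of $\mathbb N$, $G_{\cal A}(p)=\bigcup_{A\in{\cal A}}(A\to p)$; for $f,g:\mathcal P(\mathbb N)\to\mathcal P(\mathbb N)$, $f\le g$ means $\bigcap_{p\subseteq\mathbb N}(f(p)\to g(p))\ne\emptyset$. A finite $\alpha$ is identified with $\{1,\ldots,\alpha\}$ and $\omega$ with $\mathbb N$; for $m\le\alpha$, $O^\alpha_m=\{X\subseteq\alpha\mid|\alpha\setminus X|=m\}$. -}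

module Defs where

open import Level using (Level; _⊔_) renaming (suc to lsuc)
open import Data.Nat using (ℕ; zero; suc; _+_; _*_; _≤_; _<_; _%_; _/_)
open import Data.Product using (Σ; _×_; _,_; proj₁; proj₂; ∃-syntax)
open import Data.Maybe using (Maybe; just; nothing; _>>=_)
open import Data.List using (List; length)
open import Data.List.Membership.Propositional using (_∈_)
open import Data.List.Relation.Unary.Unique.Propositional using (Unique)
open import Data.Unit using (⊤)
open import Relation.Nullary using (¬_)
open import Relation.Binary.PropositionalEquality using (_≡_)
open import Function.Bundles using (_⇔_)

tri : ℕ → ℕ
tri zero    = zero
tri (suc n) = suc n + tri n

pair : ℕ → ℕ → ℕ
pair a b = tri (a + b) + b

nextPair : ℕ × ℕ → ℕ × ℕ
nextPair (zero  , b) = (suc b , zero)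
nextPair (suc a , b) = (a , suc b)

unpair : ℕ → ℕ × ℕ
unpair zero    = (zero , zero)
unpair (suc n) = nextPair (unpair n)

-- A standard Gödel numbering of the (unary, pairing-based) partial
-- recursive functions.  A code e has tag  e % 9  and arguments
-- (i , j) = unpair (e / 9):
--   0 : x ↦ 0            1 : x ↦ x+1          2 : x ↦ x
--   3 : x ↦ π₁ x         4 : x ↦ π₂ x
--   5 : composition      x ↦ i (j x)
--   6 : pairing          x ↦ ⟨ i x , j x ⟩
--   7 : prim. recursion  ⟨y,0⟩ ↦ i y ;  ⟨y,n+1⟩ ↦ j ⟨y,⟨n, r(y,n)⟩⟩
--   8 : minimisation     x ↦ least n with i ⟨x,n⟩ = 0
-- eval k e x evaluates with fuel k.

mutual
  eval : ℕ → ℕ → ℕ → Maybe ℕ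
  eval zero    e x = nothing
  eval (suc k) e x = evalTag k (e % 9) (proj₁ (unpair (e / 9))) (proj₂ (unpair (e / 9))) x

  evalTag : ℕ → ℕ → ℕ → ℕ → ℕ → Maybe ℕ
  evalTag k 0 i j x = just 0
  evalTag k 1 i j x = just (suc x)
  evalTag k 2 i j x = just x
  evalTag k 3 i j x = just (proj₁ (unpair x))
  evalTag k 4 i j x = just (proj₂ (unpair x))
  evalTag k 5 i j x = eval k j x >>= eval k i
  evalTag k 6 i j x = eval k i x >>= λ u → eval k j x >>= λ v → just (pair u v)
  evalTag k 7 i j x = evalRec k i j (proj₁ (unpair x)) (proj₂ (unpair x))
  evalTag k 8 i j x = evalMu k i x 0
  evalTag k _ i j x = nothing

  evalRec : ℕ → ℕ → ℕ → ℕ → ℕ → Maybe ℕ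
  evalRec k i j y zero    = eval k i y
  evalRec k i j y (suc n) = evalRec k i j y n >>= λ r → eval k j (pair y (pair n r))

  evalMu : ℕ → ℕ → ℕ → ℕ → Maybe ℕ
  evalMu zero    i x n = nothing
  evalMu (suc k) i x n with eval k i (pair x n)
  ... | nothing      = nothing
  ... | just zero    = just n
  ... | just (suc _) = evalMu k i x (suc n)

_·_↓_ : ℕ → ℕ → ℕ → Set
e · x ↓ y = ∃[ k ] (eval k e x ≡ just y)

_⇒_ : ∀ {a c : Level} → (ℕ → Set a) → (ℕ → Set c) → ℕ → Set (a ⊔ c)
(A ⇒ C) e = ∀ x → A x → ∃[ y ] (e · x ↓ y × C y)

Family : Set₁
Family = (ℕ → Set) → Set

G : Family → (ℕ → Set) → ℕ → Set₁
G 𝒜 p e = Σ (ℕ → Set) λ A → 𝒜 A × (A ⇒ p) e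

_≤ᴹ_ : ((ℕ → Set) → ℕ → Set₁) → ((ℕ → Set) → ℕ → Set₁) → Set₁
f ≤ᴹ g = ∃[ e ] (∀ (p : ℕ → Set) → (f p ⇒ g p) e)

-- α ∈ ℕ ∪ {ω}; finite α is {1,…,α}, ω is ℕ.

data Ord : Set where
  fin : ℕ → Ord
  ω   : Ord

_∈α_ : ℕ → Ord → Set
k ∈α fin n = 1 ≤ k × k ≤ n
k ∈α ω     = ⊤

_<α_ : ℕ → Ord → Set
k <α fin n = k < n
k <α ω     = ⊤

O : Ord → ℕ → Family
O α m X = (∀ k → X k → k ∈α α)
        × ∃[ l ] (length l ≡ m × Unique l × (∀ k → (k ∈ l) ⇔ (k ∈α α × ¬ X k)))

-- A set X with an m-point complement contains one with an (m+1)-point complement, and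
-- A → p ⊆ B → p whenever B ⊆ A, so the identity code witnesses G_{O_m} ≤ G_{O_{m+1}}.
-- Conversely, a reduction e sends the identity, which realizes α∖S → α∖S for every
-- (m+1)-point S ⊆ α, to one and the same code c; for each such S it realizes B_S → α∖S
-- for some B_S with an m-point complement.  Off the complement of one B_S, c is defined on
-- m+1 points of {1,…,2m+1} ⊆ α; taking S to contain their ≤ m+1 values forces all those
-- points into the m-point complement of the corresponding B_S, contradicting pigeonhole.

module Submission where

open import Defs
open import Data.Nat using (ℕ; zero; suc; _+_; _*_; _∸_; _≤_; _<_; s≤s; z≤n; _%_)
open import Data.Nat.Properties
open import Data.Product using (_×_; _,_; proj₁; proj₂; ∃-syntax)
open import Data.Maybe using (Maybe; just; _>>=_)
open import Data.Maybe.Properties using (just-injective)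
open import Data.Unit using (tt)
open import Data.List using (List; []; _∷_; length; _++_; applyUpTo; removeAt; deduplicate)
open import Data.List.Properties using (length-applyUpTo; length-removeAt′; length-++; length-deduplicate)
open import Data.List.Membership.Propositional using (_∈_; _∉_; find)
open import Data.List.Membership.Propositional.Properties
  using (∈-applyUpTo⁻; ∈-++⁺ˡ; ∈-++⁺ʳ; ∈-deduplicate⁺)
open import Data.List.Membership.DecPropositional _≟_ using (_∈?_)
open import Data.List.Relation.Unary.Any using (here; there; index)
open import Data.List.Relation.Unary.All as All using (All; []; _∷_; all?)
open import Data.List.Relation.Unary.All.Properties using (¬All⇒Any¬; ¬Any⇒All¬; deduplicate⁺)
  renaming (++⁺ to All-++⁺)
open import Data.List.Relation.Unary.AllPairs using ([]; _∷_)
open import Data.List.Relation.Unary.Unique.Propositional using (Unique)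
open import Data.List.Relation.Unary.Unique.Propositional.Properties using (applyUpTo⁺₁; ++⁺)
open import Data.List.Relation.Unary.Unique.DecPropositional.Properties _≟_ using (deduplicate-!)
open import Data.List.Relation.Binary.Subset.Propositional using (_⊆_)
open import Level using (0ℓ)
open import Function using (_∘_)
open import Relation.Nullary using (¬_; yes; no; contradiction)
open import Relation.Nullary.Decidable using (decidable-stable)
open import Relation.Nullary.Negation using (¬¬-Monad; ¬¬-map)
open import Relation.Binary.PropositionalEquality
open import Function.Bundles using (_⇔_; mk⇔; Equivalence)

FuelMonotone : Maybe ℕ → Maybe ℕ → Set
FuelMonotone r r′ = ∀ {y} → r ≡ just y → r′ ≡ just y

bind-monotone : ∀ {r r′ : Maybe ℕ} {f f′ : ℕ → Maybe ℕ} →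
  FuelMonotone r r′ → (∀ u → FuelMonotone (f u) (f′ u)) →
  FuelMonotone (r >>= f) (r′ >>= f′)
bind-monotone {just u} r⊑r′ f⊑f′ eq rewrite r⊑r′ refl = f⊑f′ u eq

mutual
  eval-suc : ∀ k e x → FuelMonotone (eval k e x) (eval (suc k) e x)
  eval-suc (suc k) e x = evalTag-suc k (e % 9) _ _ x

  evalTag-suc : ∀ k t i j x → FuelMonotone (evalTag k t i j x) (evalTag (suc k) t i j x)
  evalTag-suc k 0 i j x eq = eq
  evalTag-suc k 1 i j x eq = eq
  evalTag-suc k 2 i j x eq = eq
  evalTag-suc k 3 i j x eq = eq
  evalTag-suc k 4 i j x eq = eq
  evalTag-suc k 5 i j x = bind-monotone (eval-suc k j x) (eval-suc k i)
  evalTag-suc k 6 i j x = bind-monotone (eval-suc k i x) λ _ →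
    bind-monotone (eval-suc k j x) λ _ eq → eq
  evalTag-suc k 7 i j x = evalRec-suc k i j _ (proj₂ (unpair x))
  evalTag-suc k 8 i j x = evalMu-suc k i x 0

  evalRec-suc : ∀ k i j y n → FuelMonotone (evalRec k i j y n) (evalRec (suc k) i j y n)
  evalRec-suc k i j y zero    = eval-suc k i y
  evalRec-suc k i j y (suc n) = bind-monotone (evalRec-suc k i j y n) λ r → eval-suc k j _

  evalMu-suc : ∀ k i x n → FuelMonotone (evalMu k i x n) (evalMu (suc k) i x n)
  evalMu-suc (suc k) i x n eq with eval k i (pair x n) in q
  ... | just zero    rewrite eval-suc k i (pair x n) q = eq
  ... | just (suc _) rewrite eval-suc k i (pair x n) q = evalMu-suc k i x (suc n) eq

eval-+ : ∀ j k e x → FuelMonotone (eval k e x) (eval (j + k) e x)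
eval-+ zero    k e x eq = eq
eval-+ (suc j) k e x eq = eval-suc (j + k) e x (eval-+ j k e x eq)

↓-functional : ∀ {e x y y′} → e · x ↓ y → e · x ↓ y′ → y ≡ y′
↓-functional {e} {x} (k , ev) (k′ , ev′) = just-injective (begin
  just _           ≡⟨ eval-+ k′ k e x ev ⟨
  eval (k′ + k) e x ≡⟨ cong (λ j → eval j e x) (+-comm k′ k) ⟩
  eval (k + k′) e x ≡⟨ eval-+ k k′ e x ev′ ⟩
  just _           ∎)
  where open ≡-Reasoning

∈-removeAt : ∀ {x y} {ys : List ℕ} (x∈ys : x ∈ ys) → y ∈ ys → x ≢ y → y ∈ removeAt ys (index x∈ys)
∈-removeAt (here refl) (here refl) x≢y = contradiction refl x≢y
∈-removeAt (here refl) (there y∈ys) _   = y∈ys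
∈-removeAt (there x∈ys) (here refl) _   = here refl
∈-removeAt (there x∈ys) (there y∈ys) x≢y = there (∈-removeAt x∈ys y∈ys x≢y)

Unique⇒length≤ : ∀ {xs ys : List ℕ} → Unique xs → xs ⊆ ys → length xs ≤ length ys
Unique⇒length≤ {[]}     _              _     = z≤n
Unique⇒length≤ {x ∷ xs} {ys} (x∉xs ∷ u) xs⊆ys =
  subst (suc (length xs) ≤_) (sym (length-removeAt′ ys (index x∈ys)))
    (s≤s (Unique⇒length≤ u (λ y∈xs → ∈-removeAt x∈ys (xs⊆ys (there y∈xs)) (All.lookup x∉xs y∈xs))))
  where
  x∈ys = xs⊆ys (here refl)

range : ℕ → List ℕ
range = applyUpTo suc

range-unique : ∀ n → Unique (range n)
range-unique n = applyUpTo⁺₁ suc n (λ i<j _ → <⇒≢ (s≤s i<j))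

∈-range⁻ : ∀ {n k} → k ∈ range n → k ∈α fin n
∈-range⁻ k∈ with i , i<n , refl ← ∈-applyUpTo⁻ suc k∈ = s≤s z≤n , i<n

fresh : ∀ n (xs : List ℕ) → length xs < n → ∃[ k ] (k ∈α fin n × k ∉ xs)
fresh n xs xs<n with all? (_∈? xs) (range n)
... | yes range⊆xs = contradiction (Unique⇒length≤ (range-unique n) (All.lookup range⊆xs))
                       (<⇒≱ (subst (length xs <_) (sym (length-applyUpTo suc n)) xs<n))
... | no ¬range⊆xs with k , k∈range , k∉xs ← find (¬All⇒Any¬ (_∈? xs) (range n) ¬range⊆xs)
  = k , ∈-range⁻ k∈range , k∉xs

fresh-list : ∀ r n (xs : List ℕ) → r + length xs ≤ n →
  ∃[ ys ] (length ys ≡ r × Unique ys × All (_∉ xs) ys × All (_∈α fin n) ys)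
fresh-list zero    n xs _    = [] , refl , [] , [] , []
fresh-list (suc r) n xs r+xs<n
  with ys , |ys| , ys! , ys∉xs , ys⊆n ← fresh-list r n xs (<⇒≤ r+xs<n)
  with k , k∈n , k∉ys++xs ← fresh n (ys ++ xs)
         (subst (_< n) (trans (cong (_+ length xs) (sym |ys|)) (sym (length-++ ys))) r+xs<n)
  = k ∷ ys , cong suc |ys| , ¬Any⇒All¬ ys (k∉ys++xs ∘ ∈-++⁺ˡ) ∷ ys!
  , (k∉ys++xs ∘ ∈-++⁺ʳ ys) ∷ ys∉xs , k∈n ∷ ys⊆n

fin-suc⊆α : ∀ {n k} α → n <α α → k ∈α fin (suc n) → k ∈α α
fin-suc⊆α (fin a) n<a (1≤k , k≤n) = 1≤k , ≤-trans k≤n n<a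
fin-suc⊆α ω       _   _           = tt

<α-halve : ∀ {m} α → (2 * m) <α α → m <α α
<α-halve {m} (fin a) 2m<a = ≤-<-trans (m≤m+n m (m + 0)) 2m<a
<α-halve     ω       _    = tt

unique-extension : ∀ {n} α {D : List ℕ} → n <α α → Unique D → All (_∈α α) D → length D ≤ suc n →
  ∃[ S ] (length S ≡ suc n × Unique S × All (_∈α α) S × D ⊆ S)
unique-extension {n} α {D} n<α D! D⊆α |D|≤
  with ys , |ys| , ys! , ys∉D , ys⊆n ← fresh-list (suc n ∸ length D) (suc n) D (≤-reflexive (m∸n+n≡m |D|≤))
  = ys ++ D
  , trans (length-++ ys) (trans (cong (_+ length D) |ys|) (m∸n+n≡m |D|≤))
  , ++⁺ ys! D! (λ (v∈ys , v∈D) → All.lookup ys∉D v∈ys v∈D)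
  , All-++⁺ (All.map (fin-suc⊆α α n<α) ys⊆n) D⊆α
  , ∈-++⁺ʳ ys

unique-superset : ∀ {n} α {V : List ℕ} → n <α α → All (_∈α α) V → length V ≤ suc n →
  ∃[ S ] (length S ≡ suc n × Unique S × All (_∈α α) S × V ⊆ S)
unique-superset α {V} n<α V⊆α |V|≤
  with S , |S| , S! , S⊆α , D⊆S ← unique-extension α n<α (deduplicate-! V) (deduplicate⁺ _≟_ V⊆α)
                                     (≤-trans (length-deduplicate _≟_ V) |V|≤)
  = S , |S| , S! , S⊆α , D⊆S ∘ ∈-deduplicate⁺ _≟_

IsComplement : Ord → (ℕ → Set) → List ℕ → Set
IsComplement α X l = ∀ k → (k ∈ l) ⇔ (k ∈α α × ¬ X k)

Complement : Ord → List ℕ → ℕ → Set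
Complement α S k = k ∈α α × k ∉ S

Complement∈O : ∀ {n} α {S : List ℕ} → length S ≡ n → Unique S → All (_∈α α) S → O α n (Complement α S)
Complement∈O α {S} |S| S! S⊆α = (λ _ → proj₁) , S , |S| , S! , λ k → mk⇔
  (λ k∈S → All.lookup S⊆α k∈S , λ (_ , k∉S) → k∉S k∈S)
  (λ (kα , k∉Complement) → decidable-stable (k ∈? S) (λ k∉S → k∉Complement (kα , k∉S)))

O-remove-point : ∀ {m} α {X : ℕ → Set} → m <α α → O α m X →
  ∃[ Y ] (O α (suc m) Y × (∀ {k} → Y k → X k))
O-remove-point {m} α {X} m<α (X⊆α , l , |l| , l! , l-co)
  with k₀ , k₀∈m+1 , k₀∉l ← fresh (suc m) l (≤-reflexive (cong suc |l|))
  = (λ k → X k × k ≢ k₀)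
  , ((λ k → X⊆α k ∘ proj₁) , k₀ ∷ l , cong suc |l| , ¬Any⇒All¬ l k₀∉l ∷ l! , λ k → mk⇔ (to k) (from k))
  , proj₁
  where
  k₀∈α = fin-suc⊆α α m<α k₀∈m+1
  to : ∀ k → k ∈ k₀ ∷ l → k ∈α α × ¬ (X k × k ≢ k₀)
  to k (here refl)  = k₀∈α , λ (_ , k₀≢k₀) → k₀≢k₀ refl
  to k (there k∈l) with kα , ¬Xk ← Equivalence.to (l-co k) k∈l = kα , ¬Xk ∘ proj₁
  from : ∀ k → k ∈α α × ¬ (X k × k ≢ k₀) → k ∈ k₀ ∷ l
  from k (kα , ¬Yk) with k ≟ k₀
  ... | yes refl = here refl
  ... | no  k≢k₀ = there (Equivalence.from (l-co k) (kα , λ Xk → ¬Yk (Xk , k≢k₀)))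

identity-↓ : ∀ x → 2 · x ↓ x
identity-↓ x = 1 , refl

identity-⇒ : ∀ {A : ℕ → Set} → (A ⇒ A) 2
identity-⇒ x Ax = x , identity-↓ x , Ax

G-≤ᴹ-refinement : ∀ {𝒜 ℬ : Family} → (∀ {X} → 𝒜 X → ∃[ Y ] (ℬ Y × (∀ {k} → Y k → X k))) → G 𝒜 ≤ᴹ G ℬ
G-≤ᴹ-refinement refine = 2 , λ p x (X , X∈𝒜 , x∶X⇒p) →
  let Y , Y∈ℬ , Y⊆X = refine X∈𝒜 in
  x , identity-↓ x , Y , Y∈ℬ , λ k → x∶X⇒p k ∘ Y⊆X

Lands : ∀ {ℓ} → ℕ → (ℕ → Set ℓ) → ℕ → Set ℓ
Lands c C x = ∃[ y ] (c · x ↓ y × C y)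

image : ∀ {c} {C : ℕ → Set} {K : List ℕ} → All (Lands c C) K → List ℕ
image = All.reduce proj₁

length-image : ∀ {c} {C : ℕ → Set} {K : List ℕ} (ls : All (Lands c C) K) → length (image ls) ≡ length K
length-image []       = refl
length-image (_ ∷ ls) = cong suc (length-image ls)

image⊆C : ∀ {c} {C : ℕ → Set} {K : List ℕ} (ls : All (Lands c C) K) → All C (image ls)
image⊆C []                   = []
image⊆C ((_ , _ , Cy) ∷ ls) = Cy ∷ image⊆C ls

∈-image : ∀ {c k y} {C : ℕ → Set} {K : List ℕ} (ls : All (Lands c C) K) → k ∈ K → c · k ↓ y → y ∈ image ls
∈-image ((_ , ↓y′ , _) ∷ _)  (here refl) ↓y = here (↓-functional ↓y ↓y′)
∈-image (_ ∷ ls)             (there k∈K) ↓y = there (∈-image ls k∈K ↓y)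

∉complement⇒¬¬Lands : ∀ {α B c k} {C : ℕ → Set} {l : List ℕ} → IsComplement α B l → (B ⇒ C) c →
  k ∈α α → k ∉ l → ¬ ¬ Lands c C k
∉complement⇒¬¬Lands {k = k} l-co c∶B⇒C kα k∉l ¬lands =
  k∉l (Equivalence.from (l-co k) (kα , ¬lands ∘ c∶B⇒C k))

¬Lands⇒∈complement : ∀ {α B c k} {C : ℕ → Set} {l : List ℕ} → IsComplement α B l → (B ⇒ C) c →
  k ∈α α → ¬ Lands c C k → k ∈ l
¬Lands⇒∈complement {k = k} {l = l} l-co c∶B⇒C kα ¬lands =
  decidable-stable (k ∈? l) (λ k∉l → ∉complement⇒¬¬Lands l-co c∶B⇒C kα k∉l ¬lands)

O-realizer-¬¬lands : ∀ {m} α {B c} {C : ℕ → Set} → (2 * m) <α α → O α m B → (B ⇒ C) c →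
  ¬ ¬ (∃[ K ] (length K ≡ suc m × Unique K × All (_∈α α) K × All (Lands c C) K))
O-realizer-¬¬lands {m} α 2m<α (_ , l , |l| , _ , l-co) c∶B⇒C =
  let K , |K| , K! , K∉l , K⊆2m+1 = fresh-list (suc m) (suc (2 * m)) l
        (≤-reflexive (cong (λ n → suc (m + n)) (trans |l| (sym (+-identityʳ m)))))
      K⊆α = All.map (fin-suc⊆α α 2m<α) K⊆2m+1
  -- c is defined on B, and off l we only know ¬ ¬ B k; ¬ ¬ commutes with the finite conjunction over K.
  in ¬¬-map (λ ls → K , |K| , K! , K⊆α , ls) (All.sequenceM 0ℓ ¬¬-Monad
       (All.tabulate λ k∈K → ∉complement⇒¬¬Lands l-co c∶B⇒C (All.lookup K⊆α k∈K) (All.lookup K∉l k∈K)))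

UniformRealizer : Ord → ℕ → ℕ → Set₁
UniformRealizer α m c = ∀ S → length S ≡ suc m → Unique S → All (_∈α α) S → G (O α m) (Complement α S) c

≤ᴹ⇒UniformRealizer : ∀ {m} α → m <α α → G (O α (suc m)) ≤ᴹ G (O α m) → ∃[ c ] UniformRealizer α m c
≤ᴹ⇒UniformRealizer {m} α m<α (e , e-realizes) =
  let S₀ , |S₀| , S₀! , S₀⊆α , _ = unique-superset α m<α [] z≤n
      c , ↓c , _ = apply S₀ |S₀| S₀! S₀⊆α
  in c , λ S |S| S! S⊆α →
       let c′ , ↓c′ , c′-realizes = apply S |S| S! S⊆α
       in subst (G (O α m) (Complement α S)) (↓-functional ↓c′ ↓c) c′-realizes
  where
  apply : ∀ S → length S ≡ suc m → Unique S → All (_∈α α) S → Lands e (G (O α m) (Complement α S)) 2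
  apply S |S| S! S⊆α =
    e-realizes (Complement α S) 2 (Complement α S , Complement∈O α |S| S! S⊆α , identity-⇒)

UniformRealizer-domain≤ : ∀ {m} α {c} {K : List ℕ} → m <α α → UniformRealizer α m c →
  Unique K → All (_∈α α) K → All (Lands c (_∈α α)) K → length K ≤ suc m → length K ≤ m
UniformRealizer-domain≤ α {c} {K} m<α c-uniform K! K⊆α ls |K|≤ =
  let S , |S| , S! , S⊆α , image⊆S = unique-superset α m<α (image⊆C ls)
        (subst (_≤ _) (sym (length-image ls)) |K|≤)
      B , (_ , l , |l| , _ , l-co) , c∶B⇒ = c-uniform S |S| S! S⊆α
      K⊆l : K ⊆ l
      K⊆l = λ {k} k∈K → ¬Lands⇒∈complement l-co c∶B⇒ (All.lookup K⊆α k∈K)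
        λ (y , ↓y , _ , y∉S) → y∉S (image⊆S (∈-image ls k∈K ↓y))
  in subst (length K ≤_) |l| (Unique⇒length≤ K! K⊆l)

¬UniformRealizer : ∀ {m} α {c} → (2 * m) <α α → ¬ UniformRealizer α m c
¬UniformRealizer {m} α 2m<α c-uniform =
  let S₀ , |S₀| , S₀! , S₀⊆α , _ = unique-superset α m<α [] z≤n
      B₀ , B₀∈O , c∶B₀⇒ = c-uniform S₀ |S₀| S₀! S₀⊆α
  in O-realizer-¬¬lands α 2m<α B₀∈O c∶B₀⇒ λ (K , |K| , K! , K⊆α , ls) →
       1+n≰n (subst (_≤ m) |K| (UniformRealizer-domain≤ α m<α c-uniform K! K⊆α
         (All.map (λ (y , ↓y , yα , _) → y , ↓y , yα) ls) (≤-reflexive |K|)))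
  where
  m<α = <α-halve α 2m<α

proposition5p1 : (m : ℕ) (α : Ord) → 1 ≤ m → 1 < 2 * m → (2 * m) <α α →
    (G (O α m) ≤ᴹ G (O α (suc m))) × ¬ (G (O α (suc m)) ≤ᴹ G (O α m))
proposition5p1 m α _ _ 2m<α =
    G-≤ᴹ-refinement (O-remove-point α m<α)
  , λ ≤ᴹ → ¬UniformRealizer α 2m<α (proj₂ (≤ᴹ⇒UniformRealizer α m<α ≤ᴹ))
  where
  m<α = <α-halve α 2m<α
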